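{- Let $G$ be a graph which is not a complete graph and let $H$ be a graph with no pendant vertices and $|V(H)|\ge 2$. Then $G\times H$ admits a barbell partition.
   Context: All graphs are finite and simple; a pendant vertex is a vertex of degree $1$. $G\times H$ (tensor product) has vertex set $V(G)\times V(H)$, with $(g_1,h_1)(g_2,h_2)$ an edge iff $g_1g_2\in E(G)$ and $h_1h_2\in E(H)$. A barbell partition of a graph $K$ is a partition of $V(K)$ into three disjoint sets $\{R,W_1,W_2\}$ with $W_1,W_2\neq\emptyset$ ($R$ may be empty), no edges between $W_1$ and $W_2$, and $|N_K(r)\cap W_i|\neq 1$ for all $r\in R$, $i\in\{1,2\}$. -}

module Defs where

open import Data.Nat using (ℕ; zero; suc; _+_; _*_; _≤_)
open import Data.Fin using (Fin; zero; suc; quotient; remainder)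
open import Data.Bool using (Bool; true; false; _∧_)
open import Data.Product using (Σ; ∃; _×_; _,_)
open import Relation.Binary.PropositionalEquality using (_≡_; _≢_)
open import Relation.Nullary using (¬_)

record Graph (n : ℕ) : Set where
  field
    adj   : Fin n → Fin n → Bool
    sym   : ∀ u v → adj u v ≡ adj v u
    irrefl : ∀ v → adj v v ≡ false
open Graph public

count : ∀ {n} → (Fin n → Bool) → ℕ
count {zero}  P = 0
count {suc n} P with P zero
... | true  = suc (count (λ i → P (suc i)))
... | false = count (λ i → P (suc i))

IsComplete : ∀ {n} → Graph n → Set
IsComplete {n} G = ∀ (u v : Fin n) → u ≢ v → adj G u v ≡ true

degree : ∀ {n} → Graph n → Fin n → ℕ
degree G v = count (adj G v)

NoPendant : ∀ {n} → Graph n → Set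
NoPendant {n} H = ∀ (v : Fin n) → degree H v ≢ 1

-- Tensor product G × H on vertex set Fin (n * m) ≅ Fin n × Fin m
-- (vertex k corresponds to (quotient m k , remainder m k)).
tensorAdj : ∀ {n m} → Graph n → Graph m → Fin (n * m) → Fin (n * m) → Bool
tensorAdj {n} {m} G H x y =
  adj G (quotient m x) (quotient m y) ∧ adj H (remainder {n} m x) (remainder {n} m y)

data Part : Set where
  R W₁ W₂ : Part

isPart : Part → Part → Bool
isPart R R = true
isPart W₁ W₁ = true
isPart W₂ W₂ = true
isPart _ _ = false

-- A barbell partition {R, W₁, W₂} of a graph with adjacency adjK on Fin k,
-- given as a labelling of the vertices (this is exactly a partition into
-- three disjoint sets covering all vertices).
IsBarbellPartition : ∀ {k} → (Fin k → Fin k → Bool) → (Fin k → Part) → Set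
IsBarbellPartition {k} adjK f =
  (∃ λ w → f w ≡ W₁) ×
  (∃ λ w → f w ≡ W₂) ×
  (∀ u v → f u ≡ W₁ → f v ≡ W₂ → adjK u v ≡ false) ×
  (∀ r → f r ≡ R →
     count (λ v → adjK r v ∧ isPart (f v) W₁) ≢ 1 ×
     count (λ v → adjK r v ∧ isPart (f v) W₂) ≢ 1)

HasBarbellPartition : ∀ {k} → (Fin k → Fin k → Bool) → Set
HasBarbellPartition {k} adjK = ∃ λ (f : Fin k → Part) → IsBarbellPartition adjK f

{-# OPTIONS --safe #-}
-- Pick non-adjacent vertices u ≠ v of G and put W₁ = {u} × V(H), W₂ = {v} × V(H).
-- There are no edges between W₁ and W₂ since uv ∉ E(G).  A vertex (g, h) has no
-- neighbour in {w} × V(H) if gw ∉ E(G), and otherwise its neighbours there are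
-- exactly the (w, h') with hh' ∈ E(H), of which there are deg_H(h) ≠ 1.
module Submission where

open import Defs hiding (sym)
open import Data.Nat using (ℕ; zero; suc; _*_; _≤_; s≤s)
import Data.Nat as ℕ
open import Data.Bool using (Bool; true; false; _∧_)
import Data.Bool.Properties as Bool
open import Data.Fin using (Fin; zero; suc; quotient; remainder; combine; _≟_)
open import Data.Fin.Properties using (¬∀⟶∃¬; all?; remQuot-combine; suc-injective; 0≢1+n)
open import Data.Product using (Σ; ∃; _×_; _,_; proj₁; proj₂)
open import Function using (_∘_)
open import Function.Bundles using (_⇔_; mk⇔; Equivalence)
import Function.Properties.Equivalence as ⇔
open import Relation.Binary.PropositionalEquality
open import Relation.Nullary using (¬_; Dec; yes; no; ¬?; contradiction)
open import Relation.Nullary.Decidable using (_→-dec_)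

open Equivalence using (to; from)

∧≡true⇒× : ∀ {a b} → a ∧ b ≡ true → a ≡ true × b ≡ true
∧≡true⇒× {true} {true} _ = refl , refl

×⇒∧≡true : ∀ {a b} → a ≡ true → b ≡ true → a ∧ b ≡ true
×⇒∧≡true refl refl = refl

UniquelyTrueAt : ∀ {k} → (Fin k → Bool) → Fin k → Set
UniquelyTrueAt P y = P y ≡ true × (∀ z → P z ≡ true → z ≡ y)

count≡0⇒false : ∀ {k} (P : Fin k → Bool) → count P ≡ 0 → ∀ z → P z ≡ false
count≡0⇒false {suc k} P _ z with P zero in P₀
count≡0⇒false {suc k} P _  zero    | false = P₀
count≡0⇒false {suc k} P c₀ (suc z) | false = count≡0⇒false (P ∘ suc) c₀ z

false⇒count≡0 : ∀ {k} (P : Fin k → Bool) → (∀ z → P z ≡ false) → count P ≡ 0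
false⇒count≡0 {zero}  P _ = refl
false⇒count≡0 {suc k} P none with P zero | none zero
... | false | _ = false⇒count≡0 (P ∘ suc) (none ∘ suc)

count≡1⇒uniquelyTrue : ∀ {k} (P : Fin k → Bool) → count P ≡ 1 → ∃ (UniquelyTrueAt P)
count≡1⇒uniquelyTrue {suc k} P c₁ with P zero in P₀
... | true = zero , P₀ , only-zero
  where
  only-zero : ∀ z → P z ≡ true → z ≡ zero
  only-zero zero    _  = refl
  only-zero (suc z) Pz with () ← trans (sym Pz) (count≡0⇒false (P ∘ suc) (cong ℕ.pred c₁) z)
... | false with count≡1⇒uniquelyTrue (P ∘ suc) c₁
...   | y , Py , only-y = suc y , Py , only-suc-y
  where
  only-suc-y : ∀ z → P z ≡ true → z ≡ suc y
  only-suc-y zero    Pz with () ← trans (sym P₀) Pz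
  only-suc-y (suc z) Pz = cong suc (only-y z Pz)

uniquelyTrue⇒count≡1 : ∀ {k} (P : Fin k → Bool) {y} → UniquelyTrueAt P y → count P ≡ 1
uniquelyTrue⇒count≡1 {suc k} P {y} (Py , only-y) with P zero in P₀ | y
... | true  | zero  =
  cong suc (false⇒count≡0 (P ∘ suc) λ z → Bool.¬-not λ Psz → 0≢1+n (sym (only-y (suc z) Psz)))
... | true  | suc _ with () ← only-y zero P₀
... | false | zero  with () ← trans (sym P₀) Py
... | false | suc y =
  uniquelyTrue⇒count≡1 (P ∘ suc) (Py , λ z Psz → suc-injective (only-y (suc z) Psz))

isPart≡true⇔≡ : ∀ {a b} → isPart a b ≡ true ⇔ a ≡ b
isPart≡true⇔≡ = mk⇔ forward backward
  where
  forward : ∀ {a b} → isPart a b ≡ true → a ≡ b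
  forward {R}  {R}  _ = refl
  forward {W₁} {W₁} _ = refl
  forward {W₂} {W₂} _ = refl
  backward : ∀ {a b} → a ≡ b → isPart a b ≡ true
  backward {R}  refl = refl
  backward {W₁} refl = refl
  backward {W₂} refl = refl

adjacentIfDistinct? : ∀ {n} (G : Graph n) u v → Dec (u ≢ v → adj G u v ≡ true)
adjacentIfDistinct? G u v = ¬? (u ≟ v) →-dec (adj G u v Bool.≟ true)

nonAdjacentPair : ∀ {n} (G : Graph n) → ¬ IsComplete G →
  Σ (Fin n) λ u → Σ (Fin n) λ v → u ≢ v × adj G u v ≡ false
nonAdjacentPair {n} G incomplete
  with u , ¬all ← ¬∀⟶∃¬ n _ (λ u → all? (adjacentIfDistinct? G u)) incomplete
  with v , ¬adjacentIfDistinct ← ¬∀⟶∃¬ n _ (adjacentIfDistinct? G u) ¬all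
  with u ≟ v
... | yes u≡v = contradiction (λ u≢v → contradiction u≡v u≢v) ¬adjacentIfDistinct
... | no u≢v  = u , v , u≢v , Bool.¬-not (λ uv → ¬adjacentIfDistinct (λ _ → uv))

quotient-combine : ∀ {n m} (w : Fin n) (j : Fin m) → quotient m (combine w j) ≡ w
quotient-combine w j = cong proj₁ (remQuot-combine w j)

remainder-combine : ∀ {n m} (w : Fin n) (j : Fin m) → remainder {n} m (combine w j) ≡ j
remainder-combine w j = cong proj₂ (remQuot-combine w j)

module _ {n m : ℕ} (G : Graph n) (H : Graph m) where

  tensorAdj-combine : ∀ x w j →
    tensorAdj G H x (combine w j) ≡ adj G (quotient m x) w ∧ adj H (remainder {n} m x) j
  tensorAdj-combine x w j =
    cong₂ (λ w′ j′ → adj G (quotient m x) w′ ∧ adj H (remainder {n} m x) j′)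
      (quotient-combine w j) (remainder-combine w j)

  fibreNeighbourCount≢1 : NoPendant H → ∀ x w (Q : Fin (n * m) → Bool) →
    (∀ y → Q y ≡ true ⇔ quotient m y ≡ w) →
    count (λ y → tensorAdj G H x y ∧ Q y) ≢ 1
  fibreNeighbourCount≢1 noPendant x w Q inFibre c₁
    with y , Py , only-y ← count≡1⇒uniquelyTrue _ c₁
    with xy , Qy ← ∧≡true⇒× Py
    with gy , hy ← ∧≡true⇒× xy
    = noPendant h (uniquelyTrue⇒count≡1 (adj H h) (hy , only-remainder-y))
    where
    g = quotient m x
    h = remainder {n} m x
    gw : adj G g w ≡ true
    gw = subst (λ w′ → adj G g w′ ≡ true) (to (inFibre y) Qy) gy
    only-remainder-y : ∀ j → adj H h j ≡ true → j ≡ remainder {n} m y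
    only-remainder-y j hj = begin
      j                              ≡⟨ remainder-combine w j ⟨
      remainder {n} m (combine w j)  ≡⟨ cong (remainder {n} m) (only-y (combine w j) wj-adjacent) ⟩
      remainder {n} m y              ∎
      where
      open ≡-Reasoning
      wj-adjacent : tensorAdj G H x (combine w j) ∧ Q (combine w j) ≡ true
      wj-adjacent = ×⇒∧≡true
        (trans (tensorAdj-combine x w j) (×⇒∧≡true gw hj))
        (from (inFibre (combine w j)) (quotient-combine w j))

pairLabel : ∀ {n} → Fin n → Fin n → Fin n → Part
pairLabel u v x with x ≟ u | x ≟ v
... | yes _ | _     = W₁
... | no _  | yes _ = W₂
... | no _  | no _  = R

module _ {n} {u v : Fin n} where

  pairLabel≡W₁⇔ : ∀ {x} → pairLabel u v x ≡ W₁ ⇔ x ≡ u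
  pairLabel≡W₁⇔ = mk⇔ forward λ { refl → backward }
    where
    forward : ∀ {x} → pairLabel u v x ≡ W₁ → x ≡ u
    forward {x} with x ≟ u | x ≟ v
    ... | yes x≡u | _ = λ _ → x≡u
    ... | no _ | yes _ = λ ()
    ... | no _ | no _  = λ ()
    backward : pairLabel u v u ≡ W₁
    backward with u ≟ u
    ... | yes _ = refl
    ... | no u≢u = contradiction refl u≢u

  pairLabel≡W₂⇔ : u ≢ v → ∀ {x} → pairLabel u v x ≡ W₂ ⇔ x ≡ v
  pairLabel≡W₂⇔ u≢v = mk⇔ forward λ { refl → backward }
    where
    forward : ∀ {x} → pairLabel u v x ≡ W₂ → x ≡ v
    forward {x} with x ≟ u | x ≟ v
    ... | yes _ | _ = λ ()
    ... | no _ | yes x≡v = λ _ → x≡v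
    ... | no _ | no _  = λ ()
    backward : pairLabel u v v ≡ W₂
    backward with v ≟ u | v ≟ v
    ... | yes v≡u | _ = contradiction (sym v≡u) u≢v
    ... | no _ | yes _ = refl
    ... | no _ | no v≢v = contradiction refl v≢v

module _ {n m : ℕ} (G : Graph n) (H : Graph m) where

  pairLabel∘quotient-isBarbell : NoPendant H → Fin m → ∀ {u v} → u ≢ v → adj G u v ≡ false →
    IsBarbellPartition (tensorAdj G H) (pairLabel u v ∘ quotient m)
  pairLabel∘quotient-isBarbell noPendant h₀ {u} {v} u≢v uv =
    (combine u h₀ , labelled W₁-layer) ,
    (combine v h₀ , labelled W₂-layer) ,
    noEdge ,
    λ x _ → fibreNeighbourCount≢1 G H noPendant x u _ (inLayer W₁-layer)
          , fibreNeighbourCount≢1 G H noPendant x v _ (inLayer W₂-layer)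
    where
    f = pairLabel u v ∘ quotient m
    W₁-layer : ∀ {x} → pairLabel u v x ≡ W₁ ⇔ x ≡ u
    W₁-layer = pairLabel≡W₁⇔
    W₂-layer : ∀ {x} → pairLabel u v x ≡ W₂ ⇔ x ≡ v
    W₂-layer = pairLabel≡W₂⇔ u≢v
    labelled : ∀ {p w} → (∀ {x} → pairLabel u v x ≡ p ⇔ x ≡ w) → f (combine w h₀) ≡ p
    labelled layer = from layer (quotient-combine _ h₀)
    inLayer : ∀ {p w} → (∀ {x} → pairLabel u v x ≡ p ⇔ x ≡ w) →
      ∀ y → isPart (f y) p ≡ true ⇔ quotient m y ≡ w
    inLayer layer y = ⇔.trans isPart≡true⇔≡ layer
    noEdge : ∀ x y → f x ≡ W₁ → f y ≡ W₂ → tensorAdj G H x y ≡ false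
    noEdge x y fx fy
      rewrite to W₁-layer fx | to W₂-layer fy | uv = refl

mainTheorem18 : ∀ {n m : ℕ} (G : Graph n) (H : Graph m) →
    ¬ IsComplete G → NoPendant H → 2 ≤ m →
    HasBarbellPartition (tensorAdj G H)
mainTheorem18 G H incomplete noPendant (s≤s _)
  with u , v , u≢v , uv ← nonAdjacentPair G incomplete
  = _ , pairLabel∘quotient-isBarbell G H noPendant zero u≢v uv
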